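{- Let $\alpha$ be a strong composition with exactly one inversion. Then this inversion is of the form $(i,i+1)$ for some $i$. Moreover, if $\alpha=(\alpha_1,\dots,\alpha_{i-1},\alpha_i,\alpha_i+m,\alpha_{i+2},\dots,\alpha_\ell)$ with $m>0$ and $\alpha_1\ge\dots\ge\alpha_i\ge\alpha_{i+2}\ge\dots\ge\alpha_\ell$ is a strong composition with exactly one inversion, then $$\kappa_\alpha=\sum_{t=0}^{m}\mathfrak{F}_{(\alpha_1,\dots,\alpha_{i-1},\alpha_i+t,\alpha_i+m-t,\alpha_{i+2},\dots,\alpha_\ell)}.$$
   Context: A weak composition $a=(a_1,\dots,a_\ell)$ of length $\ell$ is a finite sequence of nonnegative integers; a strong composition is one whose parts are all positive. An inversion of a strong composition $\alpha$ is a pair $(i,j)$ with $i<j$ and $\alpha_i<\alpha_j$. For weak compositions $a,b$ of length $\ell$, $b$ dominates $a$ if $b_1+\dots+b_i\ge a_1+\dots+a_i$ for all $i$; $\mathrm{flat}(a)$ is obtained by deleting the zeros of $a$; a strong composition $\beta$ refines a strong composition $\gamma$ if $\gamma$ is obtained by summing consecutive blocks of parts of $\beta$. The fundamental slide polynomial is $\mathfrak{F}_a=\sum x^b$ over weak compositions $b$ of length $\ell$ dominating $a$ with $\mathrm{flat}(b)$ refining $\mathrm{flat}(a)$, where $x^b=x_1^{b_1}\cdots x_\ell^{b_\ell}$. A diagram is a finite set of cells $(r,c)$ (row $r$ from the bottom, column $c$ from the left). A Kohnert tableau of content $a$ is a diagram filled with positive integers, exactly $a_i$ cells containing $i$ for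 each $i$, such that: (i) for each $i$ there is exactly one $i$ in each of the columns $1,\dots,a_i$; (ii) every entry in row $r$ is at least $r$; (iii) for each $i$, the cells containing $i$ weakly descend from left to right; (iv) if $i<j$ appear in the same column with $i$ above $j$, then there is an $i$ in the column immediately to the right of the cell containing that $j$, in a row strictly above it. The key polynomial is $\kappa_a=\sum_T x^{\mathrm{wt}(T)}$ over all Kohnert tableaux $T$ of content $a$, where $\mathrm{wt}(T)$ has $r$-th part equal to the number of cells in row $r$ of $T$. -}

module Defs where

open import Data.Nat using (ℕ; zero; suc; _+_; _∸_; _≤_; _<_; _≟_)
open import Data.Fin using (Fin; toℕ)
import Data.Fin as F
open import Data.Vec using (Vec; lookup; toList; tabulate; _[_]≔_)
import Data.Vec as V
open import Data.List using (List; []; _∷_; _++_; take; filter; length)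
open import Data.Nat.ListAction using (sum)
open import Data.Maybe using (Maybe; just; nothing)
open import Data.Product using (Σ; _×_; _,_; proj₁; proj₂; ∃)
open import Data.Empty using (⊥)
open import Relation.Binary.PropositionalEquality using (_≡_; _≢_)
open import Relation.Nullary using (¬_)
open import Relation.Unary using (∁)

-- Weak compositions of length ℓ are vectors  Vec ℕ ℓ  (position k : Fin ℓ
-- is the paper's index toℕ k + 1).

Strong : ∀ {ℓ} → Vec ℕ ℓ → Set
Strong {ℓ} α = (k : Fin ℓ) → 0 < lookup α k

Inversion : ∀ {ℓ} → Vec ℕ ℓ → Fin ℓ → Fin ℓ → Set
Inversion α i j = (i F.< j) × (lookup α i < lookup α j)

UniqueInversion : ∀ {ℓ} → Vec ℕ ℓ → Fin ℓ → Fin ℓ → Set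
UniqueInversion {ℓ} α i j =
  Inversion α i j × ((i' j' : Fin ℓ) → Inversion α i' j' → (i' ≡ i) × (j' ≡ j))

ExactlyOneInversion : ∀ {ℓ} → Vec ℕ ℓ → Set
ExactlyOneInversion {ℓ} α = Σ (Fin ℓ) λ i → Σ (Fin ℓ) λ j → UniqueInversion α i j

psum : ∀ {ℓ} → ℕ → Vec ℕ ℓ → ℕ
psum k v = sum (take k (toList v))

Dominates : ∀ {ℓ} → Vec ℕ ℓ → Vec ℕ ℓ → Set
Dominates b a = (k : ℕ) → psum k a ≤ psum k b

flat : ∀ {ℓ} → Vec ℕ ℓ → List ℕ
flat v = filter (λ n → 0 <? n) (toList v)
  where open import Data.Nat using (_<?_)

data Refines : List ℕ → List ℕ → Set where
  done  : Refines [] []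
  block : ∀ {β γ} (bl : List ℕ) → bl ≢ [] → Refines β γ →
          Refines (bl ++ β) (sum bl ∷ γ)

-- a monomial x^b of the fundamental slide polynomial 𝔉_a
record SlideMonomial {ℓ} (a : Vec ℕ ℓ) : Set where
  constructor slideMon
  field
    exps     : Vec ℕ ℓ
    dominant : Dominates exps a
    refines  : Refines (flat exps) (flat a)
open SlideMonomial public

-- By condition (i) and the content condition, the entries equal to i
-- (paper value toℕ i + 1) occupy exactly columns 1,…,a_i, one in each.
-- A filled diagram of content a is therefore recorded by, for each i,
-- the list of rows [r_1,…,r_{a_i}] of the cells containing i in columns
-- 1,…,a_i (rows and columns are 1-based as in the paper).

nth : {A : Set} → List A → ℕ → Maybe A
nth []       _       = nothing
nth (x ∷ xs) zero    = just x
nth (x ∷ xs) (suc n) = nth xs n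

Has : ∀ {ℓ} → Vec (List ℕ) ℓ → Fin ℓ → ℕ → ℕ → Set
Has rows i r zero    = ⊥
Has rows i r (suc c) = nth (lookup rows i) c ≡ just r

record KohnertTableau {ℓ} (a : Vec ℕ ℓ) : Set where
  constructor kohnert
  field
    rows     : Vec (List ℕ) ℓ
    -- content a together with (i): the i's fill columns 1..a_i
    content  : (i : Fin ℓ) → length (lookup rows i) ≡ lookup a i
    rowPos   : ∀ i r c → Has rows i r c → 1 ≤ r
    -- a diagram is a set of cells, each holding one entry
    oneEntry : ∀ i j r c → Has rows i r c → Has rows j r c → i ≡ j
    -- (ii) every entry in row r is at least r
    cond-ii  : ∀ i r c → Has rows i r c → r ≤ suc (toℕ i)
    cond-iii : ∀ i r r' c c' → Has rows i r c → Has rows i r' c' → c < c' → r' ≤ r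
    -- (iv) i < j in the same column with i above j ⇒ an i in the next
    --      column strictly above that j
    cond-iv  : ∀ i j ri rj c → i F.< j → Has rows i ri c → Has rows j rj c →
               rj < ri → ∃ λ r → Has rows i r (suc c) × rj < r
open KohnertTableau public

weight : ∀ {ℓ} {a : Vec ℕ ℓ} → KohnertTableau a → Vec ℕ ℓ
weight {ℓ} T =
  tabulate λ (r : Fin ℓ) →
    V.sum (V.map (λ xs → length (filter (λ x → x ≟ suc (toℕ r)) xs)) (rows T))

-- Equality of polynomials with nonnegative integer coefficients
-- Σ_{x ∈ A} x^{wA x} = Σ_{y ∈ B} x^{wB y}  for finite index types A, B is
-- witnessed by a weight-preserving bijection.  Since the index types are
-- records carrying proofs, the round-trip laws are stated on the
-- underlying data (dA, dB) which determines the elements.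
record WeightBijection {ℓ} (A B : Set) {DA DB : Set}
                       (dA : A → DA) (dB : B → DB)
                       (wA : A → Vec ℕ ℓ) (wB : B → Vec ℕ ℓ) : Set where
  field
    to      : A → B
    from    : B → A
    from-to : ∀ x → dA (from (to x)) ≡ dA x
    to-from : ∀ y → dB (to (from y)) ≡ dB y
    to-wt   : ∀ x → wB (to x) ≡ wA x
    from-wt : ∀ y → wA (from y) ≡ wB y

shifted : ∀ {ℓ} → Vec ℕ ℓ → (i j : Fin ℓ) → (m t : ℕ) → Vec ℕ ℓ
shifted α i j m t = (α [ i ]≔ (lookup α i + t)) [ j ]≔ (lookup α i + m ∸ t)

SlideSum : ∀ {ℓ} → Vec ℕ ℓ → (i j : Fin ℓ) → ℕ → Set
SlideSum α i j m = Σ (Fin (suc m)) λ t → SlideMonomial (shifted α i j m (toℕ t))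

KeyEqSlideSum : ∀ {ℓ} → Vec ℕ ℓ → (i j : Fin ℓ) → ℕ → Set
KeyEqSlideSum α i j m =
  WeightBijection (KohnertTableau α) (SlideSum α i j m)
    rows (λ p → toℕ (proj₁ p) , exps (proj₂ p))
    weight (λ p → exps (proj₂ p))

-- A Kohnert tableau of α is forced into a rigid shape. By induction on the entry k, every cell of k
-- lies in its own row, except that cells of j = i + 1 may lie in the row of i beyond column α_i: a
-- cell of k in the own row of an earlier entry e would meet the cell of e in the same column, because
-- the hypotheses give α_e ≥ α_k (and α_e ≥ α_j when e < i). As the cells of j weakly descend, the
-- tableau is determined by the number t ≤ m of cells of j lying in the row of i, every such t occurs,
-- and the weight is (α_1, …, α_i + t, α_i + m − t, …, α_ℓ). These compositions are strong, so each
-- slide polynomial in the sum is the single monomial of its composition.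

module Submission where

open import Defs
open import Data.Nat using (ℕ; zero; suc; _+_; _∸_; _≤_; _<_; z≤n; s≤s; s≤s⁻¹; _≟_; _≤?_; _<?_)
open import Data.Nat.Properties
open import Data.Fin using (Fin; toℕ; fromℕ<)
import Data.Fin as F
import Data.Fin.Properties as FinP
open import Data.Fin.Induction using (<-wellFounded)
open import Induction.WellFounded using (WfRec; module All)
open import Level using (0ℓ)
open import Data.Vec using (Vec; lookup; toList; tabulate; _[_]≔_; _[_]%=_)
import Data.Vec as V
open import Data.Vec.Properties
  using (lookup∘tabulate; tabulate∘lookup; tabulate-cong; tabulate-∘; lookup∘update; lookup∘update′;
         lookup∘updateAt; lookup∘updateAt′; updateAt-cong-local; []≔-commutes; lookup-replicate;
         toList-injective; length-toList)
open import Data.Vec.Relation.Binary.Equality.Cast using (cast-is-id)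
open import Data.Vec.Relation.Unary.All.Properties using (lookup⁻; toList⁺)
open import Data.List using (List; []; _∷_; _++_; filter; length; replicate)
open import Data.List.Properties
  using (length-++; length-replicate; filter-++; filter-accept; filter-reject; filter-all;
         filter-complete; length-filter; ++-identityʳ)
open import Data.Maybe using (just)
open import Data.Product using (∃; ∃₂; _×_; _,_; proj₁; proj₂; map₁)
open import Data.Sum using (_⊎_; inj₁; inj₂; map₂)
open import Data.Empty using (⊥; ⊥-elim)
open import Function using (_∘_)
open import Relation.Nullary using (yes; no; contradiction)
open import Relation.Binary.PropositionalEquality
open import Algebra.Properties.CommutativeSemigroup +-commutativeSemigroup using (interchange)

open ≡-Reasoning

nth-length : ∀ (xs : List ℕ) {c r} → nth xs c ≡ just r → c < length xs
nth-length (_ ∷ _)  {zero}  _    = s≤s z≤n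
nth-length (_ ∷ xs) {suc c} cell = s≤s (nth-length xs cell)

nth-present : ∀ (xs : List ℕ) {c} → c < length xs → ∃ λ r → nth xs c ≡ just r
nth-present (x ∷ _)  {zero}  _         = x , refl
nth-present (_ ∷ xs) {suc c} (s≤s c<n) = nth-present xs c<n

nth-replicate : ∀ n {x c r : ℕ} → nth (replicate n x) c ≡ just r → c < n × r ≡ x
nth-replicate (suc n) {c = zero}  refl = s≤s z≤n , refl
nth-replicate (suc n) {c = suc c} cell = map₁ s≤s (nth-replicate n cell)

nth-replicate-++ : ∀ p {q x y c r : ℕ} → nth (replicate p x ++ replicate q y) c ≡ just r →
                   (c < p × r ≡ x) ⊎ (p ≤ c × c < p + q × r ≡ y)
nth-replicate-++ zero                cell = inj₂ (z≤n , nth-replicate _ cell)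
nth-replicate-++ (suc p) {c = zero}  refl = inj₁ (s≤s z≤n , refl)
nth-replicate-++ (suc p) {c = suc c} cell with nth-replicate-++ p cell
... | inj₁ (c<p , r≡x)          = inj₁ (s≤s c<p , r≡x)
... | inj₂ (p≤c , c<p+q , r≡y) = inj₂ (s≤s p≤c , s≤s c<p+q , r≡y)

nth-replicate-++-boundary : ∀ p {x y : ℕ} ys → nth (replicate p x ++ y ∷ ys) p ≡ just y
nth-replicate-++-boundary zero    ys = refl
nth-replicate-++-boundary (suc p) ys = nth-replicate-++-boundary p ys

length-replicate-++ : ∀ p q {x y : ℕ} → length (replicate p x ++ replicate q y) ≡ p + q
length-replicate-++ p q = trans (length-++ (replicate p _)) (cong₂ _+_ (length-replicate p) (length-replicate q))

nth-constant : ∀ (xs : List ℕ) {x} → (∀ {c r} → nth xs c ≡ just r → r ≡ x) →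
               xs ≡ replicate (length xs) x
nth-constant []       _     = refl
nth-constant (y ∷ xs) const = cong₂ _∷_ (const {0} refl) (nth-constant xs λ {c} → const {suc c})

Descending : List ℕ → Set
Descending xs = ∀ {c c' r r'} → nth xs c ≡ just r → nth xs c' ≡ just r' → c < c' → r' ≤ r

descending-twoValued : ∀ {lo hi} (xs : List ℕ) → lo < hi →
                       (∀ {c r} → nth xs c ≡ just r → r ≡ hi ⊎ r ≡ lo) → Descending xs →
                       ∃₂ λ p q → xs ≡ replicate p hi ++ replicate q lo
descending-twoValued []       _     _      _    = 0 , 0 , refl
descending-twoValued (x ∷ xs) lo<hi values desc with values {0} refl
... | inj₁ refl with descending-twoValued xs lo<hi (λ {c} → values {suc c})
                       (λ cell cell' c<c' → desc cell cell' (s≤s c<c'))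
...   | p , q , xs≡ = suc p , q , cong (_ ∷_) xs≡
descending-twoValued (x ∷ xs) lo<hi values desc | inj₂ refl =
  0 , suc (length xs) , cong (_ ∷_) (nth-constant xs allLow)
  where
  allLow : ∀ {c r} → nth xs c ≡ just r → r ≡ x
  allLow {c} cell with values {suc c} cell
  ... | inj₂ r≡lo = r≡lo
  ... | inj₁ refl = contradiction (desc {0} {suc c} refl cell (s≤s z≤n)) (<⇒≱ lo<hi)

occurrences : ℕ → List ℕ → ℕ
occurrences v xs = length (filter (_≟ v) xs)

occurrences-++ : ∀ v xs ys → occurrences v (xs ++ ys) ≡ occurrences v xs + occurrences v ys
occurrences-++ v xs ys = trans (cong length (filter-++ (_≟ v) xs ys)) (length-++ (filter (_≟ v) xs))

occurrences-replicate-self : ∀ n v → occurrences v (replicate n v) ≡ n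
occurrences-replicate-self zero    v = refl
occurrences-replicate-self (suc n) v =
  trans (cong length (filter-accept (_≟ v) refl)) (cong suc (occurrences-replicate-self n v))

occurrences-replicate-other : ∀ n {v w} → w ≢ v → occurrences v (replicate n w) ≡ 0
occurrences-replicate-other zero    w≢v = refl
occurrences-replicate-other (suc n) {v} w≢v =
  trans (cong length (filter-reject (_≟ v) w≢v)) (occurrences-replicate-other n w≢v)

sum-tabulate-+ : ∀ {n} (f g : Fin n → ℕ) →
                 V.sum (tabulate λ k → f k + g k) ≡ V.sum (tabulate f) + V.sum (tabulate g)
sum-tabulate-+ {zero}  f g = refl
sum-tabulate-+ {suc n} f g =
  trans (cong (f F.zero + g F.zero +_) (sum-tabulate-+ (f ∘ F.suc) (g ∘ F.suc)))
        (interchange (f F.zero) (g F.zero) _ _)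

sum-tabulate-zero : ∀ {n} (f : Fin n → ℕ) → (∀ k → f k ≡ 0) → V.sum (tabulate f) ≡ 0
sum-tabulate-zero {zero}  f _   = refl
sum-tabulate-zero {suc n} f f≡0 = cong₂ _+_ (f≡0 F.zero) (sum-tabulate-zero (f ∘ F.suc) (f≡0 ∘ F.suc))

sum-tabulate-single : ∀ {n} (f : Fin n → ℕ) r → (∀ k → k ≢ r → f k ≡ 0) → V.sum (tabulate f) ≡ f r
sum-tabulate-single f F.zero f≡0 =
  trans (cong (f F.zero +_) (sum-tabulate-zero (f ∘ F.suc) λ k → f≡0 (F.suc k) λ ()))
        (+-identityʳ _)
sum-tabulate-single f (F.suc r) f≡0 =
  cong₂ _+_ (f≡0 F.zero λ ())
            (sum-tabulate-single (f ∘ F.suc) r λ k k≢r → f≡0 (F.suc k) (k≢r ∘ FinP.suc-injective))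

sum-replicate-zero-[]≔ : ∀ n (k : Fin n) t → V.sum (V.replicate n 0 [ k ]≔ t) ≡ t
sum-replicate-zero-[]≔ n k t = begin
  V.sum v                     ≡⟨ cong V.sum (tabulate∘lookup v) ⟨
  V.sum (tabulate (lookup v)) ≡⟨ sum-tabulate-single (lookup v) k zeroElsewhere ⟩
  lookup v k                  ≡⟨ lookup∘update k (V.replicate n 0) t ⟩
  t                           ∎
  where
  v : Vec ℕ n
  v = V.replicate n 0 [ k ]≔ t
  zeroElsewhere : ∀ r → r ≢ k → lookup v r ≡ 0
  zeroElsewhere r r≢k = trans (lookup∘update′ r≢k (V.replicate n 0) t) (lookup-replicate r 0)

Strong-[]≔ : ∀ {ℓ} {v : Vec ℕ ℓ} {x} (k : Fin ℓ) → Strong v → 0 < x → Strong (v [ k ]≔ x)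
Strong-[]≔ {v = v} k strong 0<x r with r F.≟ k
... | yes refl = subst (0 <_) (sym (lookup∘update r v _)) 0<x
... | no r≢k   = subst (0 <_) (sym (lookup∘update′ r≢k v _)) (strong r)

Refines-refl : ∀ xs → Refines xs xs
Refines-refl []       = done
Refines-refl (x ∷ xs) =
  subst (λ y → Refines (x ∷ xs) (y ∷ xs)) (+-identityʳ x) (block (x ∷ []) (λ ()) (Refines-refl xs))

length-≤-++ : ∀ (xs : List ℕ) {ys} → length ys ≤ length (xs ++ ys)
length-≤-++ xs {ys} = ≤-trans (m≤n+m (length ys) (length xs)) (≤-reflexive (sym (length-++ xs)))

Refines-length : ∀ {β γ} → Refines β γ → length γ ≤ length β
Refines-length done                     = z≤n
Refines-length (block []       ne _)    = contradiction refl ne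
Refines-length (block (_ ∷ bl) _  rest) = s≤s (≤-trans (Refines-length rest) (length-≤-++ bl))

Refines-≡ : ∀ {β γ} → Refines β γ → length β ≤ length γ → β ≡ γ
Refines-≡ done                         _         = refl
Refines-≡ (block []           ne _)    _         = contradiction refl ne
Refines-≡ (block (x ∷ [])     _  rest) (s≤s len) = cong₂ _∷_ (sym (+-identityʳ x)) (Refines-≡ rest len)
Refines-≡ (block (_ ∷ _ ∷ bl) _  rest) (s≤s len) =
  contradiction (≤-trans len (≤-trans (Refines-length rest) (length-≤-++ bl))) (<-irrefl refl)

flat-strong : ∀ {ℓ} {a : Vec ℕ ℓ} → Strong a → flat a ≡ toList a
flat-strong strong = filter-all (0 <?_) (toList⁺ (lookup⁻ strong))

slideMonomial-unique : ∀ {ℓ} {a : Vec ℕ ℓ} → Strong a → (s : SlideMonomial a) → exps s ≡ a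
slideMonomial-unique {ℓ} {a} strong s =
  trans (sym (cast-is-id refl e)) (toList-injective refl e a (Refines-≡ refinesAll sameLength))
  where
  e : Vec ℕ ℓ
  e = exps s
  sameLength : length (toList e) ≤ length (toList a)
  sameLength = ≤-reflexive (trans (length-toList e) (sym (length-toList a)))
  refines′ : Refines (flat e) (toList a)
  refines′ = subst (Refines (flat e)) (flat-strong strong) (refines s)
  flat-complete : flat e ≡ toList e
  flat-complete = filter-complete (0 <?_)
    (≤-antisym (length-filter (0 <?_) (toList e)) (≤-trans sameLength (Refines-length refines′)))
  refinesAll : Refines (toList e) (toList a)
  refinesAll = subst (λ β → Refines β (toList a)) flat-complete refines′

slideMonomial-of : ∀ {ℓ} {a : Vec ℕ ℓ} (b : Vec ℕ ℓ) → b ≡ a → SlideMonomial a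
slideMonomial-of b b≡a =
  slideMon b (subst (Dominates b) b≡a λ _ → ≤-refl)
             (subst (λ a → Refines (flat b) (flat a)) b≡a (Refines-refl (flat b)))

module _ {ℓ} {α : Vec ℕ ℓ} where

  uniqueInversion-noneBetween : ∀ {i j} → UniqueInversion α i j → ∀ k → i F.< k → k F.< j → ⊥
  uniqueInversion-noneBetween {i} {j} ((_ , αi<αj) , unique) k i<k k<j with lookup α i <? lookup α k
  ... | yes αi<αk = <-irrefl (cong toℕ (proj₂ (unique i k (i<k , αi<αk)))) k<j
  ... | no  αi≮αk =
    <-irrefl (cong toℕ (sym (proj₁ (unique k j (k<j , ≤-<-trans (≮⇒≥ αi≮αk) αi<αj))))) i<k

  uniqueInversion-adjacent : ∀ {i j} → UniqueInversion α i j → toℕ j ≡ suc (toℕ i)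
  uniqueInversion-adjacent {i} {j} inv@((i<j , _) , _) with m≤n⇒m<n∨m≡n i<j
  ... | inj₂ adjacent = sym adjacent
  ... | inj₁ gap =
    ⊥-elim (uniqueInversion-noneBetween inv k (≤-reflexive (sym toℕk)) (subst (_< toℕ j) (sym toℕk) gap))
    where
    k : Fin ℓ
    k = fromℕ< (<-trans gap (FinP.toℕ<n j))
    toℕk : toℕ k ≡ suc (toℕ i)
    toℕk = FinP.toℕ-fromℕ< _

  exactlyOneInversion-unique : ExactlyOneInversion α → ∀ {i j} → Inversion α i j → UniqueInversion α i j
  exactlyOneInversion-unique (_ , _ , _ , unique) {i} {j} inv with unique i j inv
  ... | refl , refl = inv , unique

  uniqueInversion-dominates : ∀ {i j} → UniqueInversion α i j →
                              ∀ k → k F.< j → k ≢ i → lookup α j ≤ lookup α k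
  uniqueInversion-dominates {j = j} (_ , unique) k k<j k≢i with lookup α j ≤? lookup α k
  ... | yes αj≤αk = αj≤αk
  ... | no  αj≰αk = contradiction (proj₁ (unique k j (k<j , ≰⇒> αj≰αk))) k≢i

-- Entry k (the paper's value k + 1) and its row in the superstandard tableau.
ownRow : ∀ {ℓ} → Fin ℓ → ℕ
ownRow k = suc (toℕ k)

ownRow-injective : ∀ {ℓ} {k k' : Fin ℓ} → ownRow k ≡ ownRow k' → k ≡ k'
ownRow-injective = FinP.toℕ-injective ∘ suc-injective

entryOfRow : ∀ {ℓ r} (k : Fin ℓ) → 1 ≤ r → r < ownRow k → ∃ λ (e : Fin ℓ) → e F.< k × ownRow e ≡ r
entryOfRow {r = zero}  k () _
entryOfRow {r = suc s} k _  (s≤s s<k) =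
  fromℕ< (<-trans s<k (FinP.toℕ<n k)) , subst (_< toℕ k) (sym toℕe) s<k , cong suc toℕe
  where
  toℕe : toℕ (fromℕ< (<-trans s<k (FinP.toℕ<n k))) ≡ s
  toℕe = FinP.toℕ-fromℕ< (<-trans s<k (FinP.toℕ<n k))

-- weight T is definitionally weightOf (rows T).
weightOf : ∀ {ℓ} → Vec (List ℕ) ℓ → Vec ℕ ℓ
weightOf R = tabulate λ r → V.sum (V.map (occurrences (ownRow r)) R)

column-rows-monotone : ∀ {ℓ} (R : Vec (List ℕ) ℓ) →
  (∀ k r c → Has R k r c → r ≤ ownRow k) → (∀ k r c → Has R k r c → ownRow k ≤ suc r) →
  ∀ {k k' rk rk' c} → k F.< k' → Has R k rk c → Has R k' rk' c → rk ≤ rk'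
column-rows-monotone R below above {k} {k'} {rk} {rk'} {c} k<k' cell cell' =
  ≤-trans (below k rk c cell) (s≤s⁻¹ (≤-trans (s≤s k<k') (above k' rk' c cell')))

twoBlockRows : ∀ {ℓ} → Vec ℕ ℓ → Vec ℕ ℓ → Fin ℓ → Vec (List ℕ) ℓ
twoBlockRows p q ρ = tabulate λ k → replicate (lookup p k) (ownRow k) ++ replicate (lookup q k) (ownRow ρ)

weightOf-twoBlockRows : ∀ {ℓ} (p q : Vec ℕ ℓ) ρ → weightOf (twoBlockRows p q ρ) ≡ p [ ρ ]%= (_+ V.sum q)
weightOf-twoBlockRows {ℓ} p q ρ = trans (tabulate-cong weightAt) (tabulate∘lookup _)
  where
  cellsOf : Fin ℓ → List ℕ
  cellsOf k = replicate (lookup p k) (ownRow k) ++ replicate (lookup q k) (ownRow ρ)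

  ownBlocks lowBlocks : Fin ℓ → Fin ℓ → ℕ
  ownBlocks r k = occurrences (ownRow r) (replicate (lookup p k) (ownRow k))
  lowBlocks r k = occurrences (ownRow r) (replicate (lookup q k) (ownRow ρ))

  split : ∀ r → V.sum (V.map (occurrences (ownRow r)) (twoBlockRows p q ρ)) ≡
                lookup p r + V.sum (tabulate (lowBlocks r))
  split r = begin
    V.sum (V.map (occurrences (ownRow r)) (twoBlockRows p q ρ))
      ≡⟨ cong V.sum (tabulate-∘ (occurrences (ownRow r)) cellsOf) ⟨
    V.sum (tabulate (occurrences (ownRow r) ∘ cellsOf))
      ≡⟨ cong V.sum (tabulate-cong λ k → occurrences-++ (ownRow r) (replicate (lookup p k) (ownRow k)) _) ⟩
    V.sum (tabulate λ k → ownBlocks r k + lowBlocks r k)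
      ≡⟨ sum-tabulate-+ (ownBlocks r) (lowBlocks r) ⟩
    V.sum (tabulate (ownBlocks r)) + V.sum (tabulate (lowBlocks r))
      ≡⟨ cong (_+ V.sum (tabulate (lowBlocks r))) ownBlocksSum ⟩
    lookup p r + V.sum (tabulate (lowBlocks r)) ∎
    where
    ownBlocksSum : V.sum (tabulate (ownBlocks r)) ≡ lookup p r
    ownBlocksSum = trans (sum-tabulate-single (ownBlocks r) r λ k k≢r →
                            occurrences-replicate-other (lookup p k) (k≢r ∘ ownRow-injective))
                         (occurrences-replicate-self (lookup p r) (ownRow r))

  weightAt : ∀ r → V.sum (V.map (occurrences (ownRow r)) (twoBlockRows p q ρ)) ≡
                   lookup (p [ ρ ]%= (_+ V.sum q)) r
  weightAt r with ρ F.≟ r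
  ... | yes refl = begin
    _                                 ≡⟨ split ρ ⟩
    lookup p ρ + V.sum (tabulate (lowBlocks ρ))
      ≡⟨ cong (λ s → lookup p ρ + V.sum s) (tabulate-cong λ k → occurrences-replicate-self (lookup q k) _) ⟩
    lookup p ρ + V.sum (tabulate (lookup q)) ≡⟨ cong (λ s → lookup p ρ + V.sum s) (tabulate∘lookup q) ⟩
    lookup p ρ + V.sum q              ≡⟨ lookup∘updateAt ρ p ⟨
    lookup (p [ ρ ]%= (_+ V.sum q)) ρ ∎
  ... | no ρ≢r = begin
    _                           ≡⟨ split r ⟩
    lookup p r + V.sum (tabulate (lowBlocks r))
      ≡⟨ cong (lookup p r +_) (sum-tabulate-zero (lowBlocks r) λ k →
                                 occurrences-replicate-other (lookup q k) (ρ≢r ∘ ownRow-injective)) ⟩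
    lookup p r + 0              ≡⟨ +-identityʳ _ ⟩
    lookup p r                  ≡⟨ lookup∘updateAt′ r ρ (ρ≢r ∘ sym) p ⟨
    lookup (p [ ρ ]%= (_+ V.sum q)) r ∎

module KeyExpansion {ℓ} (α : Vec ℕ ℓ) (i j : Fin ℓ) (m : ℕ)
  (j≡1+i : toℕ j ≡ suc (toℕ i))
  (αj≡αi+m : lookup α j ≡ lookup α i + m)
  (decreasing : ∀ p q → p ≢ j → q ≢ j → p F.≤ q → lookup α q ≤ lookup α p)
  (dominated : ∀ k → k F.< i → lookup α j ≤ lookup α k)
  (strong : Strong α) where

  a : ℕ
  a = lookup α i

  i<j : i F.< j
  i<j = ≤-reflexive (sym j≡1+i)

  i≢j : i ≢ j
  i≢j = FinP.<⇒≢ i<j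

  ownRow-j : ownRow j ≡ suc (ownRow i)
  ownRow-j = cong suc j≡1+i

  ownRow-i<ownRow-j : ownRow i < ownRow j
  ownRow-i<ownRow-j = ≤-reflexive (sym ownRow-j)

  a≤αj : a ≤ lookup α j
  a≤αj = subst (a ≤_) (sym αj≡αi+m) (m≤m+n a m)

  a≤a+m∸ : ∀ {t} → t ≤ m → a ≤ a + m ∸ t
  a≤a+m∸ {t} t≤m = subst (a ≤_) (sym (+-∸-assoc a t≤m)) (m≤m+n a (m ∸ t))

  heights lowCells : ℕ → Vec ℕ ℓ
  heights  t = α [ j ]≔ (a + m ∸ t)
  lowCells t = V.replicate ℓ 0 [ j ]≔ t

  -- The tableau of α in which the last t cells of entry j have dropped into the row of i.
  filling : ℕ → Vec (List ℕ) ℓ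
  filling t = twoBlockRows (heights t) (lowCells t) i

  heights-j : ∀ t → lookup (heights t) j ≡ a + m ∸ t
  heights-j t = lookup∘update j α _

  heights-other : ∀ t {k} → k ≢ j → lookup (heights t) k ≡ lookup α k
  heights-other t k≢j = lookup∘update′ k≢j α _

  lowCells-j : ∀ t → lookup (lowCells t) j ≡ t
  lowCells-j t = lookup∘update j (V.replicate ℓ 0) t

  lowCells-other : ∀ t {k} → k ≢ j → lookup (lowCells t) k ≡ 0
  lowCells-other t {k} k≢j = trans (lookup∘update′ k≢j (V.replicate ℓ 0) t) (lookup-replicate k 0)

  lookup-filling : ∀ t k → lookup (filling t) k ≡
                   replicate (lookup (heights t) k) (ownRow k) ++ replicate (lookup (lowCells t) k) (ownRow i)
  lookup-filling t k = lookup∘tabulate _ k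

  weight-filling : ∀ t → weightOf (filling t) ≡ shifted α i j m t
  weight-filling t = begin
    weightOf (filling t)                       ≡⟨ weightOf-twoBlockRows (heights t) (lowCells t) i ⟩
    heights t [ i ]%= (_+ V.sum (lowCells t))  ≡⟨ cong (λ s → heights t [ i ]%= (_+ s)) (sum-replicate-zero-[]≔ ℓ j t) ⟩
    heights t [ i ]%= (_+ t)                   ≡⟨ updateAt-cong-local i (heights t) (cong (_+ t) (heights-other t i≢j)) ⟩
    heights t [ i ]≔ (a + t)                   ≡⟨ []≔-commutes α i j i≢j ⟨
    shifted α i j m t                          ∎

  shifted-i : ∀ t → lookup (shifted α i j m t) i ≡ a + t
  shifted-i t = trans (lookup∘update′ i≢j (α [ i ]≔ (a + t)) _) (lookup∘update i α _)

  shifted-strong : ∀ {t} → t ≤ m → Strong (shifted α i j m t)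
  shifted-strong {t} t≤m =
    Strong-[]≔ {v = α [ i ]≔ (a + t)} j (Strong-[]≔ {v = α} i strong (<-≤-trans (strong i) (m≤m+n a t)))
                                        (<-≤-trans (strong i) (a≤a+m∸ t≤m))

  filling-injective : ∀ {t t'} → filling t ≡ filling t' → t ≡ t'
  filling-injective {t} {t'} same = +-cancelˡ-≡ a t t' (begin
    a + t                            ≡⟨ shifted-i t ⟨
    lookup (shifted α i j m t) i     ≡⟨ cong (λ v → lookup v i) (weight-filling t) ⟨
    lookup (weightOf (filling t)) i  ≡⟨ cong (λ R → lookup (weightOf R) i) same ⟩
    lookup (weightOf (filling t')) i ≡⟨ cong (λ v → lookup v i) (weight-filling t') ⟩
    lookup (shifted α i j m t') i    ≡⟨ shifted-i t' ⟩
    a + t'                           ∎)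

  data FillingCell (t : ℕ) (k : Fin ℓ) (c r : ℕ) : Set where
    own : r ≡ ownRow k → c < lookup (heights t) k → FillingCell t k c r
    low : k ≡ j → r ≡ ownRow i → a + m ∸ t ≤ c → FillingCell t k c r

  lowCells-support : ∀ t {k} → 0 < lookup (lowCells t) k → k ≡ j
  lowCells-support t {k} 0<l with k F.≟ j
  ... | yes k≡j = k≡j
  ... | no  k≢j = contradiction (lowCells-other t k≢j) (>⇒≢ 0<l)

  fillingCell : ∀ t k {c r} → nth (lookup (filling t) k) c ≡ just r → FillingCell t k c r
  fillingCell t k cell
    with nth-replicate-++ (lookup (heights t) k) (subst (λ xs → nth xs _ ≡ _) (lookup-filling t k) cell)
  ... | inj₁ (c<h , r≡own) = own r≡own c<h
  ... | inj₂ (h≤c , c<h+l , r≡low)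
    with lowCells-support t (+-cancelˡ-< _ 0 _ (≤-<-trans (≤-trans (≤-reflexive (+-identityʳ _)) h≤c) c<h+l))
  ...   | refl = low refl r≡low (subst (_≤ _) (heights-j t) h≤c)

  module Tableau (t : ℕ) (t≤m : t ≤ m) where

    heights+lowCells : ∀ k → lookup (heights t) k + lookup (lowCells t) k ≡ lookup α k
    heights+lowCells k with k F.≟ j
    ... | yes refl = begin
      lookup (heights t) j + lookup (lowCells t) j ≡⟨ cong₂ _+_ (heights-j t) (lowCells-j t) ⟩
      a + m ∸ t + t                                ≡⟨ m∸n+n≡m (≤-trans t≤m (m≤n+m m a)) ⟩
      a + m                                        ≡⟨ αj≡αi+m ⟨
      lookup α j                                   ∎
    ... | no k≢j = trans (cong₂ _+_ (heights-other t k≢j) (lowCells-other t k≢j)) (+-identityʳ _)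

    content-filling : ∀ k → length (lookup (filling t) k) ≡ lookup α k
    content-filling k = trans (cong length (lookup-filling t k))
                              (trans (length-replicate-++ (lookup (heights t) k) _) (heights+lowCells k))

    everyCell : ∀ {P : Fin ℓ → ℕ → Set} → (∀ {k c r} → FillingCell t k c r → P k r) →
                ∀ k r c → Has (filling t) k r c → P k r
    everyCell f k r zero    ()
    everyCell f k r (suc c) cell = f (fillingCell t k cell)

    positive : ∀ {k c r} → FillingCell t k c r → 1 ≤ r
    positive (own refl _)   = s≤s z≤n
    positive (low _ refl _) = s≤s z≤n

    belowOwn : ∀ {k c r} → FillingCell t k c r → r ≤ ownRow k
    belowOwn (own refl _)      = ≤-refl
    belowOwn (low refl refl _) = <⇒≤ ownRow-i<ownRow-j

    aboveOwn : ∀ {k c r} → FillingCell t k c r → ownRow k ≤ suc r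
    aboveOwn (own refl _)      = n≤1+n _
    aboveOwn (low refl refl _) = ≤-reflexive ownRow-j

    rowOfI-disjoint : ∀ {k c} → ownRow k ≡ ownRow i → c < lookup (heights t) k → a + m ∸ t ≤ c → ⊥
    rowOfI-disjoint k≡i c<h h≤c with ownRow-injective k≡i
    ... | refl = <⇒≱ (subst (_ <_) (heights-other t i≢j) c<h) (≤-trans (a≤a+m∸ t≤m) h≤c)

    distinct : ∀ {k k' c r} → FillingCell t k c r → FillingCell t k' c r → k ≡ k'
    distinct (own refl _)        (own r≡ _)        = ownRow-injective r≡
    distinct (own refl c<h)      (low refl r≡ h≤c) = ⊥-elim (rowOfI-disjoint r≡ c<h h≤c)
    distinct (low refl refl h≤c) (own r≡ c<h)      = ⊥-elim (rowOfI-disjoint (sym r≡) c<h h≤c)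
    distinct (low refl _ _)      (low refl _ _)    = refl

    descending : ∀ {k c c' r r'} → FillingCell t k c r → FillingCell t k c' r' → c < c' → r' ≤ r
    descending (own refl _)        (own refl _)       _    = ≤-refl
    descending (own refl _)        (low refl refl _)  _    = <⇒≤ ownRow-i<ownRow-j
    descending (low refl refl h≤c) (own refl c'<h)    c<c' =
      ⊥-elim (<⇒≱ (subst (_ <_) (heights-j t) c'<h) (≤-trans h≤c (<⇒≤ c<c')))
    descending (low refl refl _)   (low refl refl _)  _    = ≤-refl

    oneEntry-filling : ∀ k k' r c → Has (filling t) k r c → Has (filling t) k' r c → k ≡ k'
    oneEntry-filling k k' r zero    ()
    oneEntry-filling k k' r (suc c) cell cell' = distinct (fillingCell t k cell) (fillingCell t k' cell')

    descending-filling : ∀ k r r' c c' → Has (filling t) k r c → Has (filling t) k r' c' → c < c' → r' ≤ r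
    descending-filling k r r' zero    c'       ()   _     _
    descending-filling k r r' (suc c) zero     _    ()    _
    descending-filling k r r' (suc c) (suc c') cell cell' (s≤s c<c') =
      descending (fillingCell t k cell) (fillingCell t k cell') c<c'

    tableau : KohnertTableau α
    tableau = kohnert (filling t) content-filling (everyCell positive) oneEntry-filling
      (everyCell belowOwn) descending-filling
      -- condition (iv) is vacuous: no column has a larger entry strictly below a smaller one
      λ k k' rk rk' c k<k' cell cell' rk'<rk →
        contradiction (column-rows-monotone (filling t) (everyCell belowOwn) (everyCell aboveOwn) k<k' cell cell')
                      (<⇒≱ rk'<rk)

  module Structure (T : KohnertTableau α) where

    cells : Fin ℓ → List ℕ
    cells k = lookup (rows T) k

    column< : ∀ {k c r} → nth (cells k) c ≡ just r → c < lookup α k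
    column< {k} cell = subst (_ <_) (content T k) (nth-length (cells k) cell)

    occupant : ∀ k {c} → c < lookup α k → ∃ λ r → nth (cells k) c ≡ just r
    occupant k c<αk = nth-present (cells k) (subst (_ <_) (sym (content T k)) c<αk)

    Settled : Fin ℓ → Set
    Settled k = ∀ {c r} → nth (cells k) c ≡ just r → r ≡ ownRow k ⊎ (k ≡ j × r ≡ ownRow i × a ≤ c)

    ownRowCell-taken : ∀ {k e c} → Settled e → e ≢ k → c < lookup α e → nth (cells k) c ≡ just (ownRow e) →
                e ≡ j × a ≤ c
    ownRowCell-taken {k} {e} {c} settledₑ e≢k c<αe cell with occupant e c<αe
    ... | r , cellₑ with settledₑ cellₑ
    ...   | inj₁ refl              = ⊥-elim (e≢k (oneEntry T e k (ownRow e) (suc c) cellₑ cell))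
    ...   | inj₂ (e≡j , _ , a≤c) = e≡j , a≤c

    other-notBelowOwnRow : ∀ {k e c} → WfRec F._<_ Settled k → k ≢ j → e F.< k →
                    nth (cells k) c ≡ just (ownRow e) → ⊥
    other-notBelowOwnRow {k} {e} settledBelow k≢j e<k cell with e F.≟ j
    ... | no e≢j = e≢j (proj₁ (ownRowCell-taken (settledBelow e<k) (FinP.<⇒≢ e<k) c<αe cell))
      where
      c<αe : _ < lookup α e
      c<αe = <-≤-trans (column< cell) (decreasing e k e≢j k≢j (<⇒≤ e<k))
    ... | yes refl = <⇒≱ c<a (proj₂ (ownRowCell-taken (settledBelow e<k) (FinP.<⇒≢ e<k) (<-≤-trans c<a a≤αj) cell))
      where
      c<a : _ < a
      c<a = <-≤-trans (column< cell) (decreasing i k i≢j k≢j (<⇒≤ (<-trans i<j e<k)))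

    j-belowOwnRow : ∀ {e c} → WfRec F._<_ Settled j → e F.< j → nth (cells j) c ≡ just (ownRow e) → e ≡ i × a ≤ c
    j-belowOwnRow {e} {c} settledBelow e<j cell with m≤n⇒m<n∨m≡n (s≤s⁻¹ (subst (toℕ e <_) j≡1+i e<j))
    ... | inj₁ e<i = ⊥-elim (FinP.<⇒≢ e<j (proj₁ (ownRowCell-taken (settledBelow e<j) (FinP.<⇒≢ e<j) c<αe cell)))
      where
      c<αe : c < lookup α e
      c<αe = <-≤-trans (column< cell) (dominated e e<i)
    ... | inj₂ e≡i with FinP.toℕ-injective e≡i | a ≤? c
    ...   | refl | yes a≤c = refl , a≤c
    ...   | refl | no  a≰c = ⊥-elim (i≢j (proj₁ (ownRowCell-taken (settledBelow e<j) i≢j (≰⇒> a≰c) cell)))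

    settled : ∀ k → Settled k
    settled = All.wfRec <-wellFounded 0ℓ Settled step
      where
      step : ∀ k → WfRec F._<_ Settled k → Settled k
      step k settledBelow {c} {r} cell with m≤n⇒m<n∨m≡n (cond-ii T k r (suc c) cell)
      ... | inj₂ r≡own = inj₁ r≡own
      ... | inj₁ r<own with entryOfRow k (rowPos T k r (suc c) cell) r<own
      ...   | e , e<k , refl with k F.≟ j
      ...     | no k≢j   = ⊥-elim (other-notBelowOwnRow settledBelow k≢j e<k cell)
      ...     | yes refl with j-belowOwnRow settledBelow e<k cell
      ...       | refl , a≤c = inj₂ (refl , refl , a≤c)

    cells-other : ∀ {k} → k ≢ j → cells k ≡ replicate (lookup α k) (ownRow k)
    cells-other {k} k≢j = trans (nth-constant (cells k) inOwnRow) (cong (λ n → replicate n (ownRow k)) (content T k))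
      where
      inOwnRow : ∀ {c r} → nth (cells k) c ≡ just r → r ≡ ownRow k
      inOwnRow cell with settled k cell
      ... | inj₁ r≡own     = r≡own
      ... | inj₂ (k≡j , _) = ⊥-elim (k≢j k≡j)

    cells-j-split : ∃₂ λ p q → cells j ≡ replicate p (ownRow j) ++ replicate q (ownRow i)
    cells-j-split = descending-twoValued (cells j) ownRow-i<ownRow-j
      (map₂ (proj₁ ∘ proj₂) ∘ settled j)
      (λ cell cell' c<c' → cond-iii T j _ _ (suc _) (suc _) cell cell' (s≤s c<c'))

    highCount lowCount : ℕ
    highCount = proj₁ cells-j-split
    lowCount  = proj₁ (proj₂ cells-j-split)

    cells-j : cells j ≡ replicate highCount (ownRow j) ++ replicate lowCount (ownRow i)
    cells-j = proj₂ (proj₂ cells-j-split)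

    high+low : highCount + lowCount ≡ a + m
    high+low = begin
      highCount + lowCount ≡⟨ length-replicate-++ highCount lowCount ⟨
      length (replicate highCount (ownRow j) ++ replicate lowCount (ownRow i)) ≡⟨ cong length cells-j ⟨
      length (cells j)     ≡⟨ content T j ⟩
      lookup α j           ≡⟨ αj≡αi+m ⟩
      a + m                ∎

    highCount≡ : highCount ≡ a + m ∸ lowCount
    highCount≡ = trans (sym (m+n∸n≡m highCount lowCount)) (cong (_∸ lowCount) high+low)

    lowCount≤m : lowCount ≤ m
    lowCount≤m = bound lowCount cells-j high+low
      where
      bound : ∀ q → cells j ≡ replicate highCount (ownRow j) ++ replicate q (ownRow i) →
              highCount + q ≡ a + m → q ≤ m
      bound zero    _        _   = z≤n
      bound (suc q) cells-j≡ sum≡ with settled j (subst (λ xs → nth xs highCount ≡ just (ownRow i)) (sym cells-j≡)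
                                                        (nth-replicate-++-boundary highCount _))
      ... | inj₁ i-row≡j-row   = ⊥-elim (<-irrefl i-row≡j-row ownRow-i<ownRow-j)
      ... | inj₂ (_ , _ , a≤h) = +-cancelˡ-≤ a _ _ (≤-trans (+-monoˡ-≤ (suc q) a≤h) (≤-reflexive sum≡))

    lowCountFin : Fin (suc m)
    lowCountFin = fromℕ< (s≤s lowCount≤m)

    rows≡filling : rows T ≡ filling (toℕ lowCountFin)
    rows≡filling = begin
      rows T                     ≡⟨ tabulate∘lookup (rows T) ⟨
      tabulate cells             ≡⟨ tabulate-cong cellsAt ⟩
      filling lowCount           ≡⟨ cong filling (FinP.toℕ-fromℕ< (s≤s lowCount≤m)) ⟨
      filling (toℕ lowCountFin)  ∎
      where
      cellsAt : ∀ k → cells k ≡ replicate (lookup (heights lowCount) k) (ownRow k) ++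
                                replicate (lookup (lowCells lowCount) k) (ownRow i)
      cellsAt k with k F.≟ j
      ... | yes refl = begin
        cells j ≡⟨ cells-j ⟩
        replicate highCount (ownRow j) ++ replicate lowCount (ownRow i)
          ≡⟨ cong₂ (λ p q → replicate p (ownRow j) ++ replicate q (ownRow i))
                   (trans highCount≡ (sym (heights-j lowCount))) (sym (lowCells-j lowCount)) ⟩
        replicate (lookup (heights lowCount) j) (ownRow j) ++ replicate (lookup (lowCells lowCount) j) (ownRow i) ∎
      ... | no k≢j = begin
        cells k ≡⟨ cells-other k≢j ⟩
        replicate (lookup α k) (ownRow k) ≡⟨ ++-identityʳ _ ⟨
        replicate (lookup α k) (ownRow k) ++ replicate 0 (ownRow i)
          ≡⟨ cong₂ (λ p q → replicate p (ownRow k) ++ replicate q (ownRow i))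
                   (sym (heights-other lowCount k≢j)) (sym (lowCells-other lowCount k≢j)) ⟩
        replicate (lookup (heights lowCount) k) (ownRow k) ++ replicate (lookup (lowCells lowCount) k) (ownRow i) ∎

    weight≡shifted : weight T ≡ shifted α i j m (toℕ lowCountFin)
    weight≡shifted = trans (cong weightOf rows≡filling) (weight-filling _)

  open Structure using (lowCountFin; rows≡filling; weight≡shifted)

  tableauOf : Fin (suc m) → KohnertTableau α
  tableauOf t = Tableau.tableau (toℕ t) (s≤s⁻¹ (FinP.toℕ<n t))

  keyEqSlideSum : KeyEqSlideSum α i j m
  keyEqSlideSum = record
    { to      = λ T → lowCountFin T , slideMonomial-of (weight T) (weight≡shifted T)
    ; from    = tableauOf ∘ proj₁
    ; from-to = sym ∘ rows≡filling
    ; to-from = λ (t , s) → cong₂ _,_ (sym (filling-injective (rows≡filling (tableauOf t))))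
                                      (weight-tableauOf t s)
    ; to-wt   = λ _ → refl
    ; from-wt = λ (t , s) → weight-tableauOf t s
    }
    where
    weight-tableauOf : ∀ t (s : SlideMonomial (shifted α i j m (toℕ t))) → weight (tableauOf t) ≡ exps s
    weight-tableauOf t s = trans (weight-filling (toℕ t))
                                 (sym (slideMonomial-unique (shifted-strong (s≤s⁻¹ (FinP.toℕ<n t))) s))

lemma3p11 :
  -- (1) the unique inversion of a strong composition is (i , i+1)
  ((ℓ : ℕ) (α : Vec ℕ ℓ) → Strong α → (i j : Fin ℓ) →
    UniqueInversion α i j → toℕ j ≡ suc (toℕ i))
  ×
  -- (2) the key polynomial expansion
  ((ℓ : ℕ) (α : Vec ℕ ℓ) (i j : Fin ℓ) (m : ℕ) →
    toℕ j ≡ suc (toℕ i) →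
    0 < m →
    lookup α j ≡ lookup α i + m →
    ((p q : Fin ℓ) → p ≢ j → q ≢ j → p F.≤ q → lookup α q ≤ lookup α p) →
    Strong α →
    ExactlyOneInversion α →
    KeyEqSlideSum α i j m)
lemma3p11 =
  (λ _ α _ _ _ → uniqueInversion-adjacent {α = α}) ,
  λ ℓ α i j m j≡1+i 0<m αj≡αi+m decreasing strong oneInversion →
    let i<j : i F.< j
        i<j = ≤-reflexive (sym j≡1+i)
        unique = exactlyOneInversion-unique {α = α} oneInversion
                   (i<j , subst (lookup α i <_) (sym αj≡αi+m) (m<m+n (lookup α i) 0<m))
    in KeyExpansion.keyEqSlideSum α i j m j≡1+i αj≡αi+m decreasing
         (λ k k<i → uniqueInversion-dominates {α = α} unique k (<-trans k<i i<j) (FinP.<⇒≢ k<i)) strong
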